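{- In the theory of (co)datatypes with default values, every first-order formula can be effectively transformed into an equivalent formula (i.e. one with the same truth value under every valuation in every structure of (co)datatypes with default values) that contains no selectors.
   Context: A (co)datatype signature consists of a set of sorts partitioned into datatypes and codatatypes, and function symbols partitioned into constructors and selectors; there are no predicate symbols. Each (co)datatype $\delta$ has $m \ge 1$ constructors; each constructor $C$ has an arity $\delta_1 \times \cdots \times \delta_n \to \delta$ and comes with selectors $\mathrm{sel}_C^j : \delta \to \delta_j$ ($j=1,\dots,n$). Constructor arguments of datatypes are datatypes, of codatatypes are codatatypes; every datatype has a ground constructor term. Constructor trees of sort $\delta$ are (possibly infinite) rooted ordered trees with root labeled by a constructor $C:\delta_1\times\cdots\times\delta_n\to\delta$ whose children in order are constructor trees of sorts $\delta_1,\dots,\delta_n$. A structure of (co)datatypes interprets codatatypes as all constructor trees of that sort, datatypes as finite constructor trees of that sort, and constructors as tree-building. In the semantics with default values, each selector $\mathrm{sel}_C^i$ has a fixed default value, denoted by a term $T_C^i$ usable in formulas, and is interpreted by $\mathrm{sel}_C^i(C(t_1,\dots,t_n)) = t_i$ and $\mathrm{sel}_C^i(t) = T_C^i$ whenever the root of $t$ is not $C$. -}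

module Defs where

open import Data.Bool using (Bool; true; false)
open import Data.Nat using (ℕ; zero; suc; _≤_; NonZero)
open import Data.Fin using (Fin; toℕ)
open import Data.List using (List; []; _∷_; length; lookup)
open import Data.List.Relation.Unary.All using (All)
open import Data.Maybe using (Maybe; just; nothing)
open import Data.Maybe.Properties using (≡-dec)
open import Data.Nat.Properties using (_≟_)
open import Data.Product using (Σ; Σ-syntax; ∃; _×_; _,_)
open import Data.Sum using (_⊎_)
open import Data.Unit using (⊤)
open import Data.Empty using (⊥)
open import Relation.Nullary using (¬_; yes; no)
open import Relation.Binary.PropositionalEquality using (_≡_)

record Sig : Set₁ where
  field
    Sort  : Set
    -- true = codatatype, false = datatype
    isCo  : Sort → Bool
    -- number m of constructors of each sort; constructors of δ are Fin (nCon δ)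
    nCon  : Sort → ℕ
    -- arity δ c = [δ₁, …, δₙ] for constructor c : δ₁ × ⋯ × δₙ → δ
    arity : (δ : Sort) → Fin (nCon δ) → List Sort

  nArg : (δ : Sort) → Fin (nCon δ) → ℕ
  nArg δ c = length (arity δ c)

  argSort : (δ : Sort) (c : Fin (nCon δ)) → Fin (nArg δ c) → Sort
  argSort δ c i = lookup (arity δ c) i

module _ (S : Sig) where
  open Sig S

  mutual
    data GroundTerm : Sort → Set where
      gcon : ∀ {δ} (c : Fin (nCon δ)) → GroundArgs (arity δ c) → GroundTerm δ

    data GroundArgs : List Sort → Set where
      []  : GroundArgs []
      _∷_ : ∀ {δ Δ} → GroundTerm δ → GroundArgs Δ → GroundArgs (δ ∷ Δ)

  record WellFormed : Set where
    field
      nCon-pos   : ∀ δ → NonZero (nCon δ)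
      arity-kind : ∀ δ c → All (λ δ′ → isCo δ′ ≡ isCo δ) (arity δ c)
      ground     : ∀ δ → isCo δ ≡ false → GroundTerm δ

-- Constructor trees (possibly infinite), represented by labelings of
-- positions: a position is a path (list of child indices) from the root,
-- the label at a position is the index of the constructor there, or
-- nothing if the position is not in the tree.

RTree : Set
RTree = List ℕ → Maybe ℕ

child : ℕ → RTree → RTree
child i t p = t (i ∷ p)

module _ (S : Sig) where
  open Sig S

  WFn : ℕ → Sort → RTree → Set
  WFn zero    δ t = ⊤
  WFn (suc n) δ t =
    Σ[ c ∈ Fin (nCon δ) ]
      (t [] ≡ just (toℕ c))
      × ((i : Fin (nArg δ c)) → WFn n (argSort δ c i) (child (toℕ i) t))
      × ((i : ℕ) → nArg δ c ≤ i → (p : List ℕ) → t (i ∷ p) ≡ nothing)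

  IsTree : Sort → RTree → Set
  IsTree δ t = (n : ℕ) → WFn n δ t

  -- t is finite (has bounded depth; trees are finitely branching)
  Finite : RTree → Set
  Finite t = ∃ λ N → (p : List ℕ) → N ≤ length p → t p ≡ nothing

  -- elements of the domain of sort δ in the structure of (co)datatypes:
  -- all constructor trees for codatatypes, finite ones for datatypes
  Elem : Sort → RTree → Set
  Elem δ t = IsTree δ t × (isCo δ ≡ false → Finite t)

  _≈_ : RTree → RTree → Set
  t ≈ u = (p : List ℕ) → t p ≡ u p

  -- Default values: a structure of (co)datatypes with default values is
  -- given by a choice of default value for each selector sel_C^i.

  Defaults : Set
  Defaults = (δ : Sort) (c : Fin (nCon δ)) (i : Fin (nArg δ c)) → RTree

  DefaultsOK : Defaults → Set
  DefaultsOK D = ∀ δ c i → Elem (argSort δ c i) (D δ c i)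

  data _∋_ : List Sort → Sort → Set where
    here  : ∀ {δ Γ} → (δ ∷ Γ) ∋ δ
    there : ∀ {δ δ′ Γ} → Γ ∋ δ → (δ′ ∷ Γ) ∋ δ

  mutual
    data Term (Γ : List Sort) : Sort → Set where
      var  : ∀ {δ} → Γ ∋ δ → Term Γ δ
      con  : ∀ {δ} (c : Fin (nCon δ)) → Terms Γ (arity δ c) → Term Γ δ
      sel  : (δ : Sort) (c : Fin (nCon δ)) (i : Fin (nArg δ c)) →
             Term Γ δ → Term Γ (argSort δ c i)
      dflt : (δ : Sort) (c : Fin (nCon δ)) (i : Fin (nArg δ c)) →
             Term Γ (argSort δ c i)

    data Terms (Γ : List Sort) : List Sort → Set where
      []  : Terms Γ []
      _∷_ : ∀ {δ Δ} → Term Γ δ → Terms Γ Δ → Terms Γ (δ ∷ Δ)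

  data Formula (Γ : List Sort) : Set where
    ⊤′   : Formula Γ
    ⊥′   : Formula Γ
    _≐_  : ∀ {δ} → Term Γ δ → Term Γ δ → Formula Γ
    ¬′_  : Formula Γ → Formula Γ
    _∧′_ : Formula Γ → Formula Γ → Formula Γ
    _∨′_ : Formula Γ → Formula Γ → Formula Γ
    _⇒′_ : Formula Γ → Formula Γ → Formula Γ
    ∀′   : (δ : Sort) → Formula (δ ∷ Γ) → Formula Γ
    ∃′   : (δ : Sort) → Formula (δ ∷ Γ) → Formula Γ

  mutual
    SelFreeT : ∀ {Γ δ} → Term Γ δ → Set
    SelFreeT (var x)      = ⊤
    SelFreeT (con c ts)   = SelFreeTs ts
    SelFreeT (sel _ _ _ _) = ⊥
    SelFreeT (dflt _ _ _) = ⊤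

    SelFreeTs : ∀ {Γ Δ} → Terms Γ Δ → Set
    SelFreeTs []       = ⊤
    SelFreeTs (t ∷ ts) = SelFreeT t × SelFreeTs ts

  SelFree : ∀ {Γ} → Formula Γ → Set
  SelFree ⊤′        = ⊤
  SelFree ⊥′        = ⊤
  SelFree (t ≐ u)   = SelFreeT t × SelFreeT u
  SelFree (¬′ φ)    = SelFree φ
  SelFree (φ ∧′ ψ)  = SelFree φ × SelFree ψ
  SelFree (φ ∨′ ψ)  = SelFree φ × SelFree ψ
  SelFree (φ ⇒′ ψ)  = SelFree φ × SelFree ψ
  SelFree (∀′ δ φ)  = SelFree φ
  SelFree (∃′ δ φ)  = SelFree φ

  Env : List Sort → Set
  Env Γ = ∀ {δ} → Γ ∋ δ → RTree

  EnvOK : ∀ {Γ} → Env Γ → Set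
  EnvOK {Γ} ρ = ∀ {δ} (x : Γ ∋ δ) → Elem δ (ρ x)

  extend : ∀ {Γ δ} → RTree → Env Γ → Env (δ ∷ Γ)
  extend t ρ here      = t
  extend t ρ (there x) = ρ x

  argsAt : List RTree → ℕ → RTree
  argsAt []       i       p = nothing
  argsAt (t ∷ ts) zero    p = t p
  argsAt (t ∷ ts) (suc i) p = argsAt ts i p

  build : ℕ → List RTree → RTree
  build c ts []      = just c
  build c ts (i ∷ p) = argsAt ts i p

  select : ℕ → ℕ → RTree → RTree → RTree
  select c i d t with ≡-dec _≟_ (t []) (just c)
  ... | yes _ = child i t
  ... | no  _ = d

  mutual
    evalT : ∀ {Γ δ} → Defaults → Env Γ → Term Γ δ → RTree
    evalT D ρ (var x)        = ρ x
    evalT D ρ (con c ts)     = build (toℕ c) (evalTs D ρ ts)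
    evalT D ρ (sel δ c i t)  = select (toℕ c) (toℕ i) (D δ c i) (evalT D ρ t)
    evalT D ρ (dflt δ c i)   = D δ c i

    evalTs : ∀ {Γ Δ} → Defaults → Env Γ → Terms Γ Δ → List RTree
    evalTs D ρ []       = []
    evalTs D ρ (t ∷ ts) = evalT D ρ t ∷ evalTs D ρ ts

  ⟦_⟧ : ∀ {Γ} → Formula Γ → Defaults → Env Γ → Set
  ⟦ ⊤′ ⟧     D ρ = ⊤
  ⟦ ⊥′ ⟧     D ρ = ⊥
  ⟦ t ≐ u ⟧  D ρ = evalT D ρ t ≈ evalT D ρ u
  ⟦ ¬′ φ ⟧   D ρ = ¬ ⟦ φ ⟧ D ρ
  ⟦ φ ∧′ ψ ⟧ D ρ = ⟦ φ ⟧ D ρ × ⟦ ψ ⟧ D ρ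
  ⟦ φ ∨′ ψ ⟧ D ρ = ⟦ φ ⟧ D ρ ⊎ ⟦ ψ ⟧ D ρ
  ⟦ φ ⇒′ ψ ⟧ D ρ = ⟦ φ ⟧ D ρ → ⟦ ψ ⟧ D ρ
  ⟦ ∀′ δ φ ⟧ D ρ = (t : RTree) → Elem δ t → ⟦ φ ⟧ D (extend t ρ)
  ⟦ ∃′ δ φ ⟧ D ρ = Σ[ t ∈ RTree ] (Elem δ t × ⟦ φ ⟧ D (extend t ρ))

  Equivalent : ∀ {Γ} → Formula Γ → Formula Γ → Set
  Equivalent {Γ} φ ψ =
    (D : Defaults) → DefaultsOK D → (ρ : Env Γ) → EnvOK ρ →
    (⟦ φ ⟧ D ρ → ⟦ ψ ⟧ D ρ) × (⟦ ψ ⟧ D ρ → ⟦ φ ⟧ D ρ)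

-- Selectors are removed from an atom innermost first: if s is selector-free, a context
-- K[sel_C^i(s)] is equivalent to (∃x̄. s = C(x̄) ∧ K[x_i]) ∨ (¬ (∃x̄. s = C(x̄)) ∧ K[T_C^i]),
-- because an element whose root is C equals C applied to its children, which are again
-- elements, while at any other element sel_C^i denotes its default value. The context K is a
-- continuation accepting a selector-free term in any extension of the variable context, which
-- makes the translation structurally recursive on terms.
module Submission where

open import Defs
open import Data.Bool using (false)
open import Data.Empty using (⊥-elim)
open import Data.Fin using (Fin; toℕ; zero; suc)
open import Data.Fin.Properties using (toℕ-injective)
open import Data.List using (List; []; _∷_; length; lookup; _++_)
open import Data.List.Membership.Propositional.Properties using (∈-lookup)
open import Data.List.Relation.Binary.Pointwise as Pointwise using (Pointwise; []; _∷_)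
open import Data.List.Relation.Unary.All as All using (All; []; _∷_)
open import Data.Maybe using (Maybe; just; nothing)
open import Data.Maybe.Properties using (≡-dec; just-injective)
open import Data.Nat using (ℕ; zero; suc; _≤_; _<_; s≤s; _⊔_)
open import Data.Nat.Properties using (_≟_; ≤-trans; n≤1+n; m≤m⊔n; m≤n⊔m; ≤-<-connex)
open import Data.Product using (Σ-syntax; ∃; _×_; _,_; proj₁; proj₂)
open import Data.Product.Function.NonDependent.Propositional using (_×-⇔_)
open import Data.Sum using (_⊎_; inj₁; inj₂)
open import Data.Sum.Function.Propositional using (_⊎-⇔_)
open import Data.Unit using (tt)
open import Function using (_∘_; id; _⇔_; mk⇔; module Equivalence)
open import Function.Construct.Composition using (_⇔-∘_)
open import Function.Related.TypeIsomorphisms using (→-cong-⇔; ¬-cong-⇔)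
open import Relation.Binary.Bundles using (Setoid)
open import Relation.Binary.Core using (Rel)
open import Relation.Binary.Definitions using (Symmetric; _Respects_)
open import Relation.Binary.PropositionalEquality using (_≡_; refl; sym; trans; _≗_; _→-setoid_)
open import Relation.Nullary using (¬_; yes; no)

open Equivalence using (to; from)
open Setoid (List ℕ →-setoid Maybe ℕ) using ()
  renaming (refl to ≗-refl; sym to ≗-sym; trans to ≗-trans)

respects⇒⇔ : ∀ {a ℓ p} {A : Set a} {_∼_ : Rel A ℓ} {P : A → Set p} →
             Symmetric _∼_ → P Respects _∼_ → ∀ {x y} → x ∼ y → P x ⇔ P y
respects⇒⇔ sym resp x∼y = mk⇔ (resp x∼y) (resp (sym x∼y))

module _ (S : Sig) where
  open Sig S

  private variable
    Γ Δ Θ Ar : List Sort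
    δ : Sort
    t v d : RTree
    ts us ws : List RTree

  Elems : List Sort → List RTree → Set
  Elems = Pointwise (Elem S)

  unfold-WFn : ∀ {n} (c : Fin (nCon δ)) → t [] ≡ just (toℕ c) → WFn S (suc n) δ t →
               ((i : Fin (nArg δ c)) → WFn S n (argSort δ c i) (child (toℕ i) t))
               × (∀ j → nArg δ c ≤ j → ∀ p → t (j ∷ p) ≡ nothing)
  unfold-WFn c root (c′ , root′ , subtrees , beyond)
    with toℕ-injective (just-injective (trans (sym root′) root))
  ... | refl = subtrees , beyond

  IsTree-child : (c : Fin (nCon δ)) → IsTree S δ t → t [] ≡ just (toℕ c) →
                 (i : Fin (nArg δ c)) → IsTree S (argSort δ c i) (child (toℕ i) t)
  IsTree-child {t = t} c tree root i n = proj₁ (unfold-WFn {t = t} c root (tree (suc n))) i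

  IsTree-beyond : (c : Fin (nCon δ)) → IsTree S δ t → t [] ≡ just (toℕ c) →
                  ∀ j → nArg δ c ≤ j → ∀ p → t (j ∷ p) ≡ nothing
  IsTree-beyond {t = t} c tree root = proj₂ (unfold-WFn {t = t} {n = 0} c root (tree 1))

  Finite-child : ∀ j → Finite S t → Finite S (child j t)
  Finite-child j (N , bounded) = N , λ p N≤ → bounded (j ∷ p) (≤-trans N≤ (n≤1+n _))

  argsAt-Elem : Elems Ar ts → (i : Fin (length Ar)) → Elem S (lookup Ar i) (argsAt S ts (toℕ i))
  argsAt-Elem (e ∷ _)  zero    = e
  argsAt-Elem (_ ∷ es) (suc i) = argsAt-Elem es i

  argsAt-beyond : Elems Ar ts → ∀ j → length Ar ≤ j → ∀ p → argsAt S ts j p ≡ nothing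
  argsAt-beyond []       j       _         p = refl
  argsAt-beyond (_ ∷ es) (suc j) (s≤s len≤) p = argsAt-beyond es j len≤ p

  argsAt-bounded : All (Finite S) ts → ∃ λ N → ∀ j p → N ≤ length p → argsAt S ts j p ≡ nothing
  argsAt-bounded [] = 0 , λ _ _ _ → refl
  argsAt-bounded ((N , bounded) ∷ fins) with argsAt-bounded fins
  ... | M , bounded′ = N ⊔ M , λ
    { zero    p le → bounded p (≤-trans (m≤m⊔n N M) le)
    ; (suc j) p le → bounded′ j p (≤-trans (m≤n⊔m N M) le)
    }

  Finite-build : ∀ c → All (Finite S) ts → Finite S (build S c ts)
  Finite-build c fins with argsAt-bounded fins
  ... | N , bounded = suc N , λ { [] () ; (j ∷ p) (s≤s le) → bounded j p le }

  argsAt-cong : Pointwise _≗_ ts us → ∀ j → argsAt S ts j ≗ argsAt S us j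
  argsAt-cong []          j       = λ _ → refl
  argsAt-cong (t≗u ∷ _)   zero    = t≗u
  argsAt-cong (_ ∷ ts≗us) (suc j) = argsAt-cong ts≗us j

  build-cong : ∀ c → Pointwise _≗_ ts us → build S c ts ≗ build S c us
  build-cong c ts≗us []      = refl
  build-cong c ts≗us (j ∷ p) = argsAt-cong ts≗us j p

  shift : RTree → RTree
  shift t []      = t []
  shift t (j ∷ p) = t (suc j ∷ p)

  children : List Sort → RTree → List RTree
  children []       t = []
  children (_ ∷ Ar) t = child 0 t ∷ children Ar (shift t)

  argsAt-children : ∀ Ar t j p → j < length Ar → argsAt S (children Ar t) j p ≡ t (j ∷ p)
  argsAt-children (_ ∷ Ar) t zero    p _          = refl
  argsAt-children (_ ∷ Ar) t (suc j) p (s≤s j<len) = argsAt-children Ar (shift t) j p j<len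

  argsAt-children-beyond : ∀ Ar t j p → length Ar ≤ j → argsAt S (children Ar t) j p ≡ nothing
  argsAt-children-beyond []       t j       p _           = refl
  argsAt-children-beyond (_ ∷ Ar) t (suc j) p (s≤s len≤j) =
    argsAt-children-beyond Ar (shift t) j p len≤j

  Elems-children : ∀ Ar t → ((i : Fin (length Ar)) → Elem S (lookup Ar i) (child (toℕ i) t)) →
                   Elems Ar (children Ar t)
  Elems-children []       t elems = []
  Elems-children (_ ∷ Ar) t elems = elems zero ∷ Elems-children Ar (shift t) (elems ∘ suc)

  build-children : (c : Fin (nCon δ)) → IsTree S δ t → t [] ≡ just (toℕ c) →
                   t ≗ build S (toℕ c) (children (arity δ c) t)
  build-children c tree root [] = root
  build-children {δ} {t} c tree root (j ∷ p) with ≤-<-connex (nArg δ c) j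
  ... | inj₁ len≤j = trans (IsTree-beyond c tree root j len≤j p)
                           (sym (argsAt-children-beyond (arity δ c) t j p len≤j))
  ... | inj₂ j<len = sym (argsAt-children (arity δ c) t j p j<len)

  select-cases : ∀ {P : RTree → Set} c i d t →
                 ((t [] ≡ just c × P (child i t)) ⊎ (¬ t [] ≡ just c × P d)) ⇔ P (select S c i d t)
  select-cases c i d t with ≡-dec _≟_ (t []) (just c)
  ... | yes root = mk⇔ (λ { (inj₁ (_ , p)) → p ; (inj₂ (¬root , _)) → ⊥-elim (¬root root) })
                       (λ p → inj₁ (root , p))
  ... | no ¬root = mk⇔ (λ { (inj₁ (root , _)) → ⊥-elim (¬root root) ; (inj₂ (_ , p)) → p })
                       (λ p → inj₂ (¬root , p))

  select-cong : ∀ c i d → t ≗ v → select S c i d t ≗ select S c i d v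
  select-cong {t} {v} c i d t≗v with ≡-dec _≟_ (t []) (just c) | ≡-dec _≟_ (v []) (just c)
  ... | yes _     | yes _     = λ p → t≗v (i ∷ p)
  ... | yes troot | no ¬vroot = ⊥-elim (¬vroot (trans (sym (t≗v [])) troot))
  ... | no ¬troot | yes vroot = ⊥-elim (¬troot (trans (t≗v []) vroot))
  ... | no _      | no _      = λ _ → refl

  module _ (W : WellFormed S) where
    open WellFormed W

    Elem-child : (c : Fin (nCon δ)) → Elem S δ t → t [] ≡ just (toℕ c) →
                 (i : Fin (nArg δ c)) → Elem S (argSort δ c i) (child (toℕ i) t)
    Elem-child {δ} c (tree , finite) root i =
      IsTree-child c tree root i ,
      λ dat → Finite-child (toℕ i)
                (finite (trans (sym (All.lookup (arity-kind δ c) (∈-lookup i))) dat))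

    Elem-build : (c : Fin (nCon δ)) → Elems (arity δ c) ts → Elem S δ (build S (toℕ c) ts)
    Elem-build {δ} {ts} c es = tree , finite
      where
      tree : IsTree S δ (build S (toℕ c) ts)
      tree zero    = tt
      tree (suc n) = c , refl , (λ i → proj₁ (argsAt-Elem es i) n) , argsAt-beyond es

      Elems-finite : Elems Ar us → All (λ δ′ → isCo δ′ ≡ false) Ar → All (Finite S) us
      Elems-finite []                  []           = []
      Elems-finite ((_ , finite) ∷ es) (dat ∷ dats) = finite dat ∷ Elems-finite es dats

      finite : isCo δ ≡ false → Finite S (build S (toℕ c) ts)
      finite dat = Finite-build (toℕ c)
        (Elems-finite es (All.map (λ same → trans same dat) (arity-kind δ c)))

    Elem-select : (c : Fin (nCon δ)) (i : Fin (nArg δ c)) → Elem S δ t → Elem S (argSort δ c i) d →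
                  Elem S (argSort δ c i) (select S (toℕ c) (toℕ i) d t)
    Elem-select {t = t} c i e e-d with ≡-dec _≟_ (t []) (just (toℕ c))
    ... | yes root = Elem-child c e root i
    ... | no _     = e-d

    decompose : (c : Fin (nCon δ)) → Elem S δ t → t [] ≡ just (toℕ c) →
                Σ[ ws ∈ List RTree ] Elems (arity δ c) ws × t ≗ build S (toℕ c) ws
    decompose {δ} {t} c e root =
      children (arity δ c) t ,
      Elems-children (arity δ c) t (Elem-child c e root) ,
      build-children c (proj₁ e) root

  Var : List Sort → Sort → Set
  Var = _∋_ S

  Ren : List Sort → List Sort → Set
  Ren Γ Δ = ∀ {δ} → Var Γ δ → Var Δ δ

  mutual
    renT : Ren Γ Δ → Term S Γ δ → Term S Δ δ
    renT r (var x)       = var (r x)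
    renT r (con c ts)    = con c (renTs r ts)
    renT r (sel δ c i t) = sel δ c i (renT r t)
    renT r (dflt δ c i)  = dflt δ c i

    renTs : Ren Γ Δ → Terms S Γ Ar → Terms S Δ Ar
    renTs r []       = []
    renTs r (t ∷ ts) = renT r t ∷ renTs r ts

  weaken : ∀ Ar → Ren Γ (Ar ++ Γ)
  weaken []       x = x
  weaken (_ ∷ Ar) x = there (weaken Ar x)

  nth : ∀ Ar (i : Fin (length Ar)) → Var (Ar ++ Γ) (lookup Ar i)
  nth (_ ∷ Ar) zero    = here
  nth (_ ∷ Ar) (suc i) = there (nth Ar i)

  vars : ∀ Ar → Terms S (Ar ++ Γ) Ar
  vars []       = []
  vars (_ ∷ Ar) = var here ∷ renTs there (vars Ar)

  ∃′* : ∀ Ar → Formula S (Ar ++ Γ) → Formula S Γ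
  ∃′* []       φ = φ
  ∃′* (δ ∷ Ar) φ = ∃′* Ar (∃′ δ φ)

  isCon : (c : Fin (nCon δ)) → Term S Γ δ → Formula S (arity δ c ++ Γ)
  isCon {δ} c s = renT (weaken (arity δ c)) s ≐ con c (vars (arity δ c))

  Cont : List Sort → Sort → Set
  Cont Γ δ = ∀ {Δ} → Ren Γ Δ → Term S Δ δ → Formula S Δ

  Conts : List Sort → List Sort → Set
  Conts Γ Ar = ∀ {Δ} → Ren Γ Δ → Terms S Δ Ar → Formula S Δ

  elimSel : ∀ δ c i → Term S Γ δ → Cont Γ (argSort δ c i) → Formula S Γ
  elimSel δ c i s K =
    ∃′* args (isCon c s ∧′ K (weaken args) (var (nth args i)))
      ∨′ ((¬′ ∃′* args (isCon c s)) ∧′ K id (dflt δ c i))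
    where args = arity δ c

  mutual
    elimT : Term S Γ δ → Ren Γ Δ → Cont Δ δ → Formula S Δ
    elimT (var x)       σ k = k id (var (σ x))
    elimT (con c ts)    σ k = elimTs ts σ (λ r us → k r (con c us))
    elimT (sel δ c i t) σ k = elimT t σ (λ r s → elimSel δ c i s (λ r′ → k (r′ ∘ r)))
    elimT (dflt δ c i)  σ k = k id (dflt δ c i)

    elimTs : Terms S Γ Ar → Ren Γ Δ → Conts Δ Ar → Formula S Δ
    elimTs []       σ k = k id []
    elimTs (t ∷ ts) σ k =
      elimT t σ (λ r s → elimTs ts (r ∘ σ) (λ r′ us → k (r′ ∘ r) (renT r′ s ∷ us)))

  elim : Formula S Γ → Formula S Γ
  elim ⊤′       = ⊤′
  elim ⊥′       = ⊥′
  elim (t ≐ u)  = elimT t id (λ r s → elimT u r (λ r′ s′ → renT r′ s ≐ s′))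
  elim (¬′ φ)   = ¬′ elim φ
  elim (φ ∧′ ψ) = elim φ ∧′ elim ψ
  elim (φ ∨′ ψ) = elim φ ∨′ elim ψ
  elim (φ ⇒′ ψ) = elim φ ⇒′ elim ψ
  elim (∀′ δ φ) = ∀′ δ (elim φ)
  elim (∃′ δ φ) = ∃′ δ (elim φ)

  mutual
    renT-SelFree : (r : Ren Γ Δ) (t : Term S Γ δ) → SelFreeT S t → SelFreeT S (renT r t)
    renT-SelFree r (var x)      _  = tt
    renT-SelFree r (con c ts)   sf = renTs-SelFree r ts sf
    renT-SelFree r (dflt δ c i) _  = tt

    renTs-SelFree : (r : Ren Γ Δ) (ts : Terms S Γ Ar) → SelFreeTs S ts → SelFreeTs S (renTs r ts)
    renTs-SelFree r []       _          = tt
    renTs-SelFree r (t ∷ ts) (sf , sfs) = renT-SelFree r t sf , renTs-SelFree r ts sfs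

  vars-SelFree : ∀ Ar → SelFreeTs S (vars {Γ} Ar)
  vars-SelFree []       = tt
  vars-SelFree (_ ∷ Ar) = tt , renTs-SelFree there (vars Ar) (vars-SelFree Ar)

  ∃′*-SelFree : ∀ Ar (φ : Formula S (Ar ++ Γ)) → SelFree S φ → SelFree S (∃′* Ar φ)
  ∃′*-SelFree []       φ sf = sf
  ∃′*-SelFree (δ ∷ Ar) φ sf = ∃′*-SelFree Ar (∃′ δ φ) sf

  isCon-SelFree : (c : Fin (nCon δ)) (s : Term S Γ δ) → SelFreeT S s → SelFree S (isCon c s)
  isCon-SelFree {δ} c s sf = renT-SelFree (weaken (arity δ c)) s sf , vars-SelFree (arity δ c)

  SelFreeCont : Cont Γ δ → Set
  SelFreeCont {Γ} k = ∀ {Δ} (r : Ren Γ Δ) u → SelFreeT S u → SelFree S (k r u)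

  SelFreeConts : Conts Γ Ar → Set
  SelFreeConts {Γ} k = ∀ {Δ} (r : Ren Γ Δ) us → SelFreeTs S us → SelFree S (k r us)

  elimSel-SelFree : ∀ δ c i (s : Term S Γ δ) {K : Cont Γ (argSort δ c i)} →
                    SelFreeT S s → SelFreeCont K → SelFree S (elimSel δ c i s K)
  elimSel-SelFree δ c i s sf K-sf =
    ∃′*-SelFree (arity δ c) _ (isCon-SelFree c s sf , K-sf _ _ tt) ,
    ∃′*-SelFree (arity δ c) _ (isCon-SelFree c s sf) , K-sf _ _ tt

  mutual
    elimT-SelFree : (t : Term S Γ δ) (σ : Ren Γ Δ) {k : Cont Δ δ} →
                    SelFreeCont k → SelFree S (elimT t σ k)
    elimT-SelFree (var x)       σ k-sf = k-sf _ _ tt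
    elimT-SelFree (con c ts)    σ k-sf = elimTs-SelFree ts σ (λ r us → k-sf r (con c us))
    elimT-SelFree (sel δ c i t) σ {k} k-sf =
      elimT-SelFree t σ (λ r s sf →
        elimSel-SelFree δ c i s {λ r′ → k (r′ ∘ r)} sf (λ r′ → k-sf (r′ ∘ r)))
    elimT-SelFree (dflt δ c i)  σ k-sf = k-sf _ _ tt

    elimTs-SelFree : (ts : Terms S Γ Ar) (σ : Ren Γ Δ) {k : Conts Δ Ar} →
                     SelFreeConts k → SelFree S (elimTs ts σ k)
    elimTs-SelFree []       σ k-sf = k-sf _ _ tt
    elimTs-SelFree (t ∷ ts) σ k-sf =
      elimT-SelFree t σ (λ r s sf →
        elimTs-SelFree ts (r ∘ σ) (λ r′ us sfs → k-sf (r′ ∘ r) _ (renT-SelFree r′ s sf , sfs)))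

  elim-SelFree : (φ : Formula S Γ) → SelFree S (elim φ)
  elim-SelFree ⊤′       = tt
  elim-SelFree ⊥′       = tt
  elim-SelFree (t ≐ u)  =
    elimT-SelFree t id (λ r s sf → elimT-SelFree u r (λ r′ s′ sf′ → renT-SelFree r′ s sf , sf′))
  elim-SelFree (¬′ φ)   = elim-SelFree φ
  elim-SelFree (φ ∧′ ψ) = elim-SelFree φ , elim-SelFree ψ
  elim-SelFree (φ ∨′ ψ) = elim-SelFree φ , elim-SelFree ψ
  elim-SelFree (φ ⇒′ ψ) = elim-SelFree φ , elim-SelFree ψ
  elim-SelFree (∀′ δ φ) = elim-SelFree φ
  elim-SelFree (∃′ δ φ) = elim-SelFree φ

  infixl 9 _∘ᵉ_
  infix  4 _≗ᴱ_

  _∘ᵉ_ : Env S Δ → Ren Γ Δ → Env S Γ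
  (ρ ∘ᵉ r) x = ρ (r x)

  _≗ᴱ_ : Env S Γ → Env S Γ → Set
  _≗ᴱ_ {Γ} ρ ρ′ = ∀ {δ} (x : Var Γ δ) → ρ x ≗ ρ′ x

  ∘ᵉ-id : (ρ : Env S Γ) → ρ ∘ᵉ id ≗ᴱ ρ
  ∘ᵉ-id ρ x _ = refl

  ≗ᴱ-∘ : {ρ₂ : Env S Θ} {ρ₁ : Env S Δ} {ρ₀ : Env S Γ} {r₂ : Ren Δ Θ} {r₁ : Ren Γ Δ} →
         ρ₂ ∘ᵉ r₂ ≗ᴱ ρ₁ → ρ₁ ∘ᵉ r₁ ≗ᴱ ρ₀ → ρ₂ ∘ᵉ (r₂ ∘ r₁) ≗ᴱ ρ₀
  ≗ᴱ-∘ {r₁ = r₁} h₂ h₁ x = ≗-trans (h₂ (r₁ x)) (h₁ x)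

  extend* : Elems Ar ws → Env S Γ → Env S (Ar ++ Γ)
  extend*              []       ρ = ρ
  extend* {ws = w ∷ _} (_ ∷ es) ρ = extend S w (extend* es ρ)

  EnvOK-extend : {ρ : Env S Γ} → Elem S δ t → EnvOK S ρ → EnvOK S (extend S {δ = δ} t ρ)
  EnvOK-extend e ok here      = e
  EnvOK-extend e ok (there x) = ok x

  EnvOK-extend* : {ρ : Env S Γ} (es : Elems Ar ws) → EnvOK S ρ → EnvOK S (extend* es ρ)
  EnvOK-extend* []       ok = ok
  EnvOK-extend* (e ∷ es) ok = EnvOK-extend e (EnvOK-extend* es ok)

  extend*-weaken : {ρ : Env S Γ} (es : Elems Ar ws) → extend* es ρ ∘ᵉ weaken Ar ≗ᴱ ρ
  extend*-weaken []       x _ = refl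
  extend*-weaken (_ ∷ es) x   = extend*-weaken es x

  extend*-nth : {ρ : Env S Γ} (es : Elems Ar ws) (i : Fin (length Ar)) →
                extend* es ρ (nth Ar i) ≗ argsAt S ws (toℕ i)
  extend*-nth (_ ∷ es) zero    _ = refl
  extend*-nth (_ ∷ es) (suc i)   = extend*-nth es i

  extend*-nth≗child : {ρ : Env S Γ} (c : Fin (nCon δ)) (es : Elems (arity δ c) ws) →
                      v ≗ build S (toℕ c) ws → (i : Fin (nArg δ c)) →
                      extend* es ρ (nth (arity δ c) i) ≗ child (toℕ i) v
  extend*-nth≗child c es v≗ i p = trans (extend*-nth es i p) (sym (v≗ (toℕ i ∷ p)))

  module _ (D : Defaults S) where
    infix 4 _⊨_
    _⊨_ : Env S Γ → Formula S Γ → Set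
    ρ ⊨ φ = ⟦_⟧ S φ D ρ

    eval : Env S Γ → Term S Γ δ → RTree
    eval = evalT S D

    evals : Env S Γ → Terms S Γ Ar → List RTree
    evals = evalTs S D

    mutual
      eval-ren : {ρ : Env S Δ} {ρ₀ : Env S Γ} (r : Ren Γ Δ) → ρ ∘ᵉ r ≗ᴱ ρ₀ →
                 (t : Term S Γ δ) → eval ρ (renT r t) ≗ eval ρ₀ t
      eval-ren r h (var x)       = h x
      eval-ren r h (con c ts)    = build-cong (toℕ c) (evals-ren r h ts)
      eval-ren r h (sel δ c i t) = select-cong (toℕ c) (toℕ i) (D δ c i) (eval-ren r h t)
      eval-ren r h (dflt δ c i)  = λ _ → refl

      evals-ren : {ρ : Env S Δ} {ρ₀ : Env S Γ} (r : Ren Γ Δ) → ρ ∘ᵉ r ≗ᴱ ρ₀ →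
                  (ts : Terms S Γ Ar) → Pointwise _≗_ (evals ρ (renTs r ts)) (evals ρ₀ ts)
      evals-ren r h []       = []
      evals-ren r h (t ∷ ts) = eval-ren r h t ∷ evals-ren r h ts

    evals-vars : {ρ : Env S Γ} (es : Elems Ar ws) →
                 Pointwise _≗_ (evals (extend* es ρ) (vars Ar)) ws
    evals-vars []       = []
    evals-vars (_ ∷ es) =
      (λ _ → refl) ∷
      Pointwise.transitive ≗-trans (evals-ren there (λ _ _ → refl) (vars _)) (evals-vars es)

    ⊨∃′* : (ρ : Env S Γ) (Ar : List Sort) (φ : Formula S (Ar ++ Γ)) →
           ρ ⊨ ∃′* Ar φ ⇔ (Σ[ ws ∈ List RTree ] Σ[ es ∈ Elems Ar ws ] extend* es ρ ⊨ φ)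
    ⊨∃′* ρ []       φ = mk⇔ (λ h → [] , [] , h) (λ { ([] , [] , h) → h })
    ⊨∃′* ρ (δ ∷ Ar) φ = mk⇔
      (λ h → let ws , es , t , e , h′ = to (⊨∃′* ρ Ar (∃′ δ φ)) h in t ∷ ws , e ∷ es , h′)
      (λ { (t ∷ ws , e ∷ es , h) → from (⊨∃′* ρ Ar (∃′ δ φ)) (ws , es , t , e , h) })

    ⊨isCon : {ρ : Env S Γ} (c : Fin (nCon δ)) (s : Term S Γ δ) (es : Elems (arity δ c) ws) →
             extend* es ρ ⊨ isCon c s ⇔ eval ρ s ≗ build S (toℕ c) ws
    ⊨isCon {δ = δ} c s es =
      mk⇔ (λ h → ≗-trans (≗-sym ren) (≗-trans h args)) (λ h → ≗-trans ren (≗-trans h (≗-sym args)))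
      where
      ren  = eval-ren (weaken (arity δ c)) (extend*-weaken es) s
      args = build-cong (toℕ c) (evals-vars es)

    Realises : Env S Γ → Cont Γ δ → (RTree → Set) → Set
    Realises {Γ} ρ k P = ∀ {Δ} (r : Ren Γ Δ) (ρ′ : Env S Δ) → EnvOK S ρ′ → ρ′ ∘ᵉ r ≗ᴱ ρ →
                         ∀ u → ρ′ ⊨ k r u ⇔ P (eval ρ′ u)

    Realisesˢ : Env S Γ → Conts Γ Ar → (List RTree → Set) → Set
    Realisesˢ {Γ} ρ k P = ∀ {Δ} (r : Ren Γ Δ) (ρ′ : Env S Δ) → EnvOK S ρ′ → ρ′ ∘ᵉ r ≗ᴱ ρ →
                          ∀ us → ρ′ ⊨ k r us ⇔ P (evals ρ′ us)

    Realises-∘ : {ρ : Env S Γ} {ρ′ : Env S Δ} {k : Cont Γ δ} {r : Ren Γ Δ} {P : RTree → Set} →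
                 Realises ρ k P → ρ′ ∘ᵉ r ≗ᴱ ρ → Realises ρ′ (λ r′ → k (r′ ∘ r)) P
    Realises-∘ {r = r} k-real h r′ ρ″ ok″ h′ =
      k-real (r′ ∘ r) ρ″ ok″ (≗ᴱ-∘ {ρ₂ = ρ″} {r₂ = r′} h′ h)

    module _ (W : WellFormed S) (D-ok : DefaultsOK S D) where
      mutual
        eval-Elem : {ρ : Env S Γ} → EnvOK S ρ → (t : Term S Γ δ) → Elem S δ (eval ρ t)
        eval-Elem ok (var x)       = ok x
        eval-Elem ok (con c ts)    = Elem-build W c (evals-Elems ok ts)
        eval-Elem ok (sel δ c i t) = Elem-select W c i (eval-Elem ok t) (D-ok δ c i)
        eval-Elem ok (dflt δ c i)  = D-ok δ c i

        evals-Elems : {ρ : Env S Γ} → EnvOK S ρ → (ts : Terms S Γ Ar) → Elems Ar (evals ρ ts)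
        evals-Elems ok []       = []
        evals-Elems ok (t ∷ ts) = eval-Elem ok t ∷ evals-Elems ok ts

      ⊨∃isCon : {ρ : Env S Γ} (c : Fin (nCon δ)) (s : Term S Γ δ) → Elem S δ (eval ρ s) →
                ρ ⊨ ∃′* (arity δ c) (isCon c s) ⇔ eval ρ s [] ≡ just (toℕ c)
      ⊨∃isCon {ρ = ρ} c s e = mk⇔
        (λ h → let _ , es , h′ = to (⊨∃′* ρ _ _) h in to (⊨isCon c s es) h′ [])
        (λ root → let ws , es , s≗ = decompose W c e root in
                  from (⊨∃′* ρ _ _) (ws , es , from (⊨isCon c s es) s≗))

      ⊨∃isCon∧ : {ρ : Env S Γ} {P : RTree → Set} (c : Fin (nCon δ)) (i : Fin (nArg δ c))
                 (s : Term S Γ δ) {K : Cont Γ (argSort δ c i)} →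
                 EnvOK S ρ → Elem S δ (eval ρ s) → P Respects _≗_ → Realises ρ K P →
                 ρ ⊨ ∃′* (arity δ c) (isCon c s ∧′ K (weaken (arity δ c)) (var (nth (arity δ c) i)))
                   ⇔ (eval ρ s [] ≡ just (toℕ c) × P (child (toℕ i) (eval ρ s)))
      ⊨∃isCon∧ {δ = δ} {ρ = ρ} {P} c i s {K} ok e resp K-real = mk⇔
        (λ h → let _ , es , at , k = to (⊨∃′* ρ _ body) h
                   s≗ = to (⊨isCon c s es) at
               in s≗ [] , to (hole es s≗) k)
        (λ { (root , p) → let ws , es , s≗ = decompose W c e root in
             from (⊨∃′* ρ _ body) (ws , es , from (⊨isCon c s es) s≗ , from (hole es s≗) p) })
        where
        body = isCon c s ∧′ K (weaken (arity δ c)) (var (nth (arity δ c) i))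

        hole : (es : Elems (arity δ c) ws) → eval ρ s ≗ build S (toℕ c) ws →
               extend* es ρ ⊨ K (weaken (arity δ c)) (var (nth (arity δ c) i))
                 ⇔ P (child (toℕ i) (eval ρ s))
        hole es s≗ =
          respects⇒⇔ {P = P} ≗-sym resp (extend*-nth≗child {ρ = ρ} c es s≗ i)
            ⇔-∘ K-real (weaken (arity δ c)) (extend* es ρ) (EnvOK-extend* es ok) (extend*-weaken es)
                       (var (nth (arity δ c) i))

      elimSel-sem : {ρ : Env S Γ} {P : RTree → Set}
                    (δ : Sort) (c : Fin (nCon δ)) (i : Fin (nArg δ c))
                    (s : Term S Γ δ) {K : Cont Γ (argSort δ c i)} →
                    EnvOK S ρ → P Respects _≗_ → Realises ρ K P →
                    ρ ⊨ elimSel δ c i s K ⇔ P (select S (toℕ c) (toℕ i) (D δ c i) (eval ρ s))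
      elimSel-sem {ρ = ρ} {P} δ c i s ok resp K-real =
        select-cases {P = P} (toℕ c) (toℕ i) (D δ c i) (eval ρ s)
          ⇔-∘ (⊨∃isCon∧ c i s ok e resp K-real
                 ⊎-⇔ (¬-cong-⇔ (⊨∃isCon c s e) ×-⇔ K-real id ρ ok (∘ᵉ-id ρ) (dflt δ c i)))
        where e = eval-Elem ok s

      -- Quantifying over all ρ₀ that agree with ρ ∘ᵉ σ spares a congruence lemma for eval.
      mutual
        elimT-sem : {σ : Ren Γ Δ} {ρ : Env S Δ} {ρ₀ : Env S Γ} {k : Cont Δ δ} {P : RTree → Set} →
                    EnvOK S ρ → ρ ∘ᵉ σ ≗ᴱ ρ₀ → P Respects _≗_ → Realises ρ k P →
                    (t : Term S Γ δ) → ρ ⊨ elimT t σ k ⇔ P (eval ρ₀ t)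
        elimT-sem {σ = σ} {ρ} {P = P} ok σ≗ resp k-real (var x) =
          respects⇒⇔ {P = P} ≗-sym resp (σ≗ x) ⇔-∘ k-real id ρ ok (∘ᵉ-id ρ) (var (σ x))
        elimT-sem ok σ≗ resp k-real (con c ts) =
          elimTs-sem ok σ≗ (λ eq → resp (build-cong (toℕ c) eq))
            (λ r ρ′ ok′ h us → k-real r ρ′ ok′ h (con c us)) ts
        elimT-sem {P = P} ok σ≗ resp k-real (sel δ c i t) =
          elimT-sem ok σ≗ (λ eq → resp (select-cong (toℕ c) (toℕ i) (D δ c i) eq))
            (λ r ρ′ ok′ h s → elimSel-sem δ c i s ok′ resp (Realises-∘ {P = P} k-real h)) t
        elimT-sem {ρ = ρ} ok σ≗ resp k-real (dflt δ c i) = k-real id ρ ok (∘ᵉ-id ρ) (dflt δ c i)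

        elimTs-sem : {σ : Ren Γ Δ} {ρ : Env S Δ} {ρ₀ : Env S Γ} {k : Conts Δ Ar}
                     {P : List RTree → Set} →
                     EnvOK S ρ → ρ ∘ᵉ σ ≗ᴱ ρ₀ → P Respects Pointwise _≗_ → Realisesˢ ρ k P →
                     (ts : Terms S Γ Ar) → ρ ⊨ elimTs ts σ k ⇔ P (evals ρ₀ ts)
        elimTs-sem {ρ = ρ} ok σ≗ resp k-real [] = k-real id ρ ok (∘ᵉ-id ρ) []
        elimTs-sem {σ = σ} {ρ} {ρ₀} {k} {P} ok σ≗ resp k-real (t ∷ ts) =
          elimT-sem ok σ≗ (λ eq → resp (eq ∷ Pointwise.refl ≗-refl)) head-real t
          where
          head-real : Realises ρ (λ r s → elimTs ts (r ∘ σ) (λ r′ us → k (r′ ∘ r) (renT r′ s ∷ us)))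
                                 (λ w → P (w ∷ evals ρ₀ ts))
          head-real r ρ′ ok′ h s =
            elimTs-sem ok′ (≗ᴱ-∘ {ρ₂ = ρ′} {r₂ = r} h σ≗) (λ eq → resp (≗-refl ∷ eq)) tail-real ts
            where
            tail-real : Realisesˢ ρ′ (λ r′ us → k (r′ ∘ r) (renT r′ s ∷ us))
                                     (λ ws → P (eval ρ′ s ∷ ws))
            tail-real r′ ρ″ ok″ h′ us =
              respects⇒⇔ {P = P} (Pointwise.symmetric ≗-sym) resp
                (eval-ren r′ h′ s ∷ Pointwise.refl ≗-refl)
                ⇔-∘ k-real (r′ ∘ r) ρ″ ok″ (≗ᴱ-∘ {ρ₂ = ρ″} {r₂ = r′} h′ h) (renT r′ s ∷ us)

      ⊨elim : {ρ : Env S Γ} → EnvOK S ρ → (φ : Formula S Γ) → ρ ⊨ elim φ ⇔ ρ ⊨ φ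
      ⊨elim ok ⊤′       = mk⇔ id id
      ⊨elim ok ⊥′       = mk⇔ id id
      ⊨elim {ρ = ρ} ok (t ≐ u) =
        elimT-sem ok (∘ᵉ-id ρ) (λ t≗t′ h → ≗-trans (≗-sym t≗t′) h) t-real t
        where
        t-real : Realises ρ (λ r s → elimT u r (λ r′ s′ → renT r′ s ≐ s′)) (λ w → w ≗ eval ρ u)
        t-real r ρ′ ok′ h s = elimT-sem ok′ h (λ u≗u′ h → ≗-trans h u≗u′) u-real u
          where
          u-real : Realises ρ′ (λ r′ s′ → renT r′ s ≐ s′) (λ w → eval ρ′ s ≗ w)
          u-real r′ ρ″ _ h′ s′ =
            respects⇒⇔ {P = λ w → w ≗ eval ρ″ s′} ≗-sym (λ w≗w′ h → ≗-trans (≗-sym w≗w′) h)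
              (eval-ren r′ h′ s)
      ⊨elim ok (¬′ φ)   = ¬-cong-⇔ (⊨elim ok φ)
      ⊨elim ok (φ ∧′ ψ) = ⊨elim ok φ ×-⇔ ⊨elim ok ψ
      ⊨elim ok (φ ∨′ ψ) = ⊨elim ok φ ⊎-⇔ ⊨elim ok ψ
      ⊨elim ok (φ ⇒′ ψ) = →-cong-⇔ (⊨elim ok φ) (⊨elim ok ψ)
      ⊨elim ok (∀′ δ φ) = mk⇔
        (λ f t e → to   (⊨elim (EnvOK-extend e ok) φ) (f t e))
        (λ f t e → from (⊨elim (EnvOK-extend e ok) φ) (f t e))
      ⊨elim ok (∃′ δ φ) = mk⇔
        (λ { (t , e , h) → t , e , to   (⊨elim (EnvOK-extend e ok) φ) h })
        (λ { (t , e , h) → t , e , from (⊨elim (EnvOK-extend e ok) φ) h })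

theorem2 : (S : Sig) → WellFormed S →
    Σ[ elim ∈ ({Γ : List (Sig.Sort S)} → Formula S Γ → Formula S Γ) ]
      ({Γ : List (Sig.Sort S)} (φ : Formula S Γ) →
        SelFree S (elim φ) × Equivalent S φ (elim φ))
theorem2 S W = elim S , λ φ →
  elim-SelFree S φ ,
  λ D D-ok ρ ok → from (⊨elim S D W D-ok ok φ) , to (⊨elim S D W D-ok ok φ)
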